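{- Let $\mathbf{L}=(\mathbf{A},G,H,F,P)$ be a tense DLI$^{+}$-algebra with $G(0)=0=H(0)$. Then the map $\alpha_{\mathbf{L}}:A\to C(K(A))$ given by $\alpha_{\mathbf{L}}(x)=(x,0)$ is an isomorphism of tense DLI$^{+}$-algebras from $\mathbf{L}$ onto $\mathrm{C}(\mathrm{K}(\mathbf{L}))$.
   Context: A DLI$^{+}$-algebra is $\langle A,\wedge,\vee,\to,0,1\rangle$ with bounded distributive lattice reduct such that $(a\to b)\wedge(a\to d)=a\to(b\wedge d)$, $(a\to d)\wedge(b\to d)=(a\vee b)\to d$, $0\to a=1$, $a\to 1=1$, $a\wedge(a\to b)\le b$. A tense DLI$^{+}$-algebra is $(\mathbf{A},G,H,F,P)$ with unary operations satisfying: $P(x)\le y$ iff $x\le G(y)$; $F(x)\le y$ iff $x\le H(y)$; $G(x)\wedge F(y)\le F(x\wedge y)$, $H(x)\wedge P(y)\le P(x\wedge y)$; $G(x\vee y)\le G(x)\vee F(y)$, $H(x\vee y)\le H(x)\vee P(y)$; $G(x\to y)\le G(x)\to G(y)$, $H(x\to y)\le H(x)\to H(y)$; $G(x\to y)\le F(x)\to F(y)$, $H(x\to y)\le P(x)\to P(y)$. $\mathrm{K}(\mathbf{L})$ is $K(A)=\{(a,b)\in A^2:a\wedge b=0\}$ with $(a,b)\vee(x,y)=(a\vee x,b\wedge y)$, $(a,b)\wedge(x,y)=(a\wedge x,b\vee y)$, $(a,b)\Rightarrow(x,y)=((a\to x)\wedge(y\to b),a\wedge y)$, $\sim(a,b)=(b,a)$,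 $0=(0,1)$, $1=(1,0)$, $c=(0,0)$, $G_K(a,b)=(G(a),F(b))$, $H_K(a,b)=(H(a),P(b))$, and $F_K(a,b)=\sim G_K(\sim(a,b))=(F(a),G(b))$, $P_K(a,b)=\sim H_K(\sim(a,b))=(P(a),H(b))$. $\mathrm{C}(\mathrm{K}(\mathbf{L}))$ is the set $C(K(A))=\{u\in K(A):u\ge c\}$ with $\wedge,\vee,\Rightarrow,G_K,H_K,F_K,P_K$ restricted, bottom $c$ and top $1$. -}

module Defs where

open import Level using (Level; suc; _⊔_)
open import Relation.Binary.PropositionalEquality using (_≡_)
open import Data.Product using (_×_; _,_; proj₁; proj₂; Σ; ∃)

record DLI+ {a : Level} (A : Set a) : Set a where
  infixr 6 _∨_
  infixr 7 _∧_
  infixr 5 _⇒_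
  field
    _∧_ _∨_ _⇒_ : A → A → A
    𝟎 𝟏 : A
    ∧-assoc : ∀ x y z → (x ∧ y) ∧ z ≡ x ∧ (y ∧ z)
    ∨-assoc : ∀ x y z → (x ∨ y) ∨ z ≡ x ∨ (y ∨ z)
    ∧-comm  : ∀ x y → x ∧ y ≡ y ∧ x
    ∨-comm  : ∀ x y → x ∨ y ≡ y ∨ x
    ∧-absorb-∨ : ∀ x y → x ∧ (x ∨ y) ≡ x
    ∨-absorb-∧ : ∀ x y → x ∨ (x ∧ y) ≡ x
    ∧-distrib-∨ : ∀ x y z → x ∧ (y ∨ z) ≡ (x ∧ y) ∨ (x ∧ z)
    𝟎-least : ∀ x → 𝟎 ∧ x ≡ 𝟎
    𝟏-greatest : ∀ x → x ∧ 𝟏 ≡ x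
    ⇒-∧ : ∀ a b d → (a ⇒ b) ∧ (a ⇒ d) ≡ a ⇒ (b ∧ d)
    ⇒-∨ : ∀ a b d → (a ⇒ d) ∧ (b ⇒ d) ≡ (a ∨ b) ⇒ d
    𝟎-⇒ : ∀ a → 𝟎 ⇒ a ≡ 𝟏
    ⇒-𝟏 : ∀ a → a ⇒ 𝟏 ≡ 𝟏
    mp : ∀ a b → (a ∧ (a ⇒ b)) ∧ b ≡ a ∧ (a ⇒ b)

  _≤_ : A → A → Set a
  x ≤ y = x ∧ y ≡ x

record TenseDLI+ {a : Level} (A : Set a) : Set a where
  field
    dli : DLI+ A
  open DLI+ dli public
  field
    G H F P : A → A
    P⊣G₁ : ∀ x y → P x ≤ y → x ≤ G y
    P⊣G₂ : ∀ x y → x ≤ G y → P x ≤ y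
    F⊣H₁ : ∀ x y → F x ≤ y → x ≤ H y
    F⊣H₂ : ∀ x y → x ≤ H y → F x ≤ y
    GF-∧ : ∀ x y → (G x ∧ F y) ≤ F (x ∧ y)
    HP-∧ : ∀ x y → (H x ∧ P y) ≤ P (x ∧ y)
    G-∨ : ∀ x y → G (x ∨ y) ≤ (G x ∨ F y)
    H-∨ : ∀ x y → H (x ∨ y) ≤ (H x ∨ P y)
    G-⇒ : ∀ x y → G (x ⇒ y) ≤ (G x ⇒ G y)
    H-⇒ : ∀ x y → H (x ⇒ y) ≤ (H x ⇒ H y)
    GF-⇒ : ∀ x y → G (x ⇒ y) ≤ (F x ⇒ F y)
    HP-⇒ : ∀ x y → H (x ⇒ y) ≤ (P x ⇒ P y)

module KConstruction {a : Level} {A : Set a} (L : TenseDLI+ A) where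
  open TenseDLI+ L

  InK : A × A → Set a
  InK (x , y) = x ∧ y ≡ 𝟎

  _∨K_ : A × A → A × A → A × A
  (a₁ , b₁) ∨K (x , y) = (a₁ ∨ x , b₁ ∧ y)

  _∧K_ : A × A → A × A → A × A
  (a₁ , b₁) ∧K (x , y) = (a₁ ∧ x , b₁ ∨ y)

  _⇒K_ : A × A → A × A → A × A
  (a₁ , b₁) ⇒K (x , y) = ((a₁ ⇒ x) ∧ (y ⇒ b₁) , a₁ ∧ y)

  ∼K : A × A → A × A
  ∼K (x , y) = (y , x)

  0K 1K cK : A × A
  0K = (𝟎 , 𝟏)
  1K = (𝟏 , 𝟎)
  cK = (𝟎 , 𝟎)

  GK HK FK PK : A × A → A × A
  GK (x , y) = (G x , F y)
  HK (x , y) = (H x , P y)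
  FK u = ∼K (GK (∼K u))
  PK u = ∼K (HK (∼K u))

  _≤K_ : A × A → A × A → Set a
  u ≤K v = u ∧K v ≡ u

  InC : A × A → Set a
  InC u = InK u × (cK ≤K u)

  α : A → A × A
  α x = (x , 𝟎)

  -- α is an isomorphism of tense DLI⁺-algebras from L onto C(K(L)):
  -- lands in C(K(A)), is injective, is onto C(K(A)), and preserves
  -- ∧, ∨, →, bottom (0 ↦ c), top (1 ↦ 1), G, H, F, P.
  IsIsoOntoC : Set a
  IsIsoOntoC =
      (∀ x → InC (α x))
    × (∀ x y → α x ≡ α y → x ≡ y)
    × (∀ u → InC u → ∃ λ x → α x ≡ u)
    × (∀ x y → α (x ∧ y) ≡ α x ∧K α y)
    × (∀ x y → α (x ∨ y) ≡ α x ∨K α y)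
    × (∀ x y → α (x ⇒ y) ≡ α x ⇒K α y)
    × (α 𝟎 ≡ cK)
    × (α 𝟏 ≡ 1K)
    × (∀ x → α (G x) ≡ GK (α x))
    × (∀ x → α (H x) ≡ HK (α x))
    × (∀ x → α (F x) ≡ FK (α x))
    × (∀ x → α (P x) ≡ PK (α x))

-- On an element (x , 𝟎) every operation of C(K(L)) acts as its counterpart on x in the
-- first coordinate; the second coordinate is built from 𝟎 alone and collapses to 𝟎:
-- for G_K and H_K because the lower adjoints F and P preserve 𝟎, for F_K and P_K
-- exactly by the hypotheses G 𝟎 ≡ 𝟎 ≡ H 𝟎.  Conversely c ≤ (x , y) forces y ≡ 𝟎.
module Submission where

open import Defs
open import Level using (Level)
open import Relation.Binary.PropositionalEquality using (_≡_; refl; sym; trans; cong; cong₂; module ≡-Reasoning)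
open import Data.Product using (_,_; proj₁; proj₂; ∃)

module DLI+Properties {a : Level} {A : Set a} (D : DLI+ A) where
  open DLI+ D

  ∧-zeroʳ : ∀ x → x ∧ 𝟎 ≡ 𝟎
  ∧-zeroʳ x = trans (∧-comm x 𝟎) (𝟎-least x)

  ∨-identityˡ : ∀ y → 𝟎 ∨ y ≡ y
  ∨-identityˡ y = begin
    𝟎 ∨ y        ≡⟨ ∨-comm 𝟎 y ⟩
    y ∨ 𝟎        ≡⟨ cong (y ∨_) (sym (∧-zeroʳ y)) ⟩
    y ∨ (y ∧ 𝟎)  ≡⟨ ∨-absorb-∧ y 𝟎 ⟩
    y            ∎
    where open ≡-Reasoning

  ∨-identityˡ⁻¹ : ∀ {y} → 𝟎 ∨ y ≡ 𝟎 → y ≡ 𝟎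
  ∨-identityˡ⁻¹ {y} e = trans (sym (∨-identityˡ y)) e

  lowerAdjoint-𝟎 : (f g : A → A) → (∀ x y → x ≤ g y → f x ≤ y) → f 𝟎 ≡ 𝟎
  lowerAdjoint-𝟎 f g f⊣g = begin
    f 𝟎      ≡⟨ sym (f⊣g 𝟎 𝟎 (𝟎-least (g 𝟎))) ⟩
    f 𝟎 ∧ 𝟎  ≡⟨ ∧-zeroʳ (f 𝟎) ⟩
    𝟎        ∎
    where open ≡-Reasoning

  ⇒-𝟎-𝟎-∧ : ∀ x → x ∧ (𝟎 ⇒ 𝟎) ≡ x
  ⇒-𝟎-𝟎-∧ x = trans (cong (x ∧_) (𝟎-⇒ 𝟎)) (𝟏-greatest x)

module α-Properties {a : Level} {A : Set a} (L : TenseDLI+ A) where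
  open TenseDLI+ L
  open KConstruction L
  open DLI+Properties dli

  F-𝟎 : F 𝟎 ≡ 𝟎
  F-𝟎 = lowerAdjoint-𝟎 F H F⊣H₂

  P-𝟎 : P 𝟎 ≡ 𝟎
  P-𝟎 = lowerAdjoint-𝟎 P G P⊣G₂

  α-InC : ∀ x → InC (α x)
  α-InC x = ∧-zeroʳ x , cong₂ _,_ (𝟎-least x) (∨-identityˡ 𝟎)

  α-injective : ∀ x y → α x ≡ α y → x ≡ y
  α-injective x y = cong proj₁

  α-surjective : ∀ u → InC u → ∃ λ x → α x ≡ u
  α-surjective (x , y) (_ , c≤u) = x , cong (x ,_) (sym (∨-identityˡ⁻¹ (cong proj₂ c≤u)))

  α-∧ : ∀ x y → α (x ∧ y) ≡ α x ∧K α y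
  α-∧ x y = cong (x ∧ y ,_) (sym (∨-identityˡ 𝟎))

  α-∨ : ∀ x y → α (x ∨ y) ≡ α x ∨K α y
  α-∨ x y = cong (x ∨ y ,_) (sym (𝟎-least 𝟎))

  α-⇒ : ∀ x y → α (x ⇒ y) ≡ α x ⇒K α y
  α-⇒ x y = cong₂ _,_ (sym (⇒-𝟎-𝟎-∧ (x ⇒ y))) (sym (∧-zeroʳ x))

  α-G : ∀ x → α (G x) ≡ GK (α x)
  α-G x = cong (G x ,_) (sym F-𝟎)

  α-H : ∀ x → α (H x) ≡ HK (α x)
  α-H x = cong (H x ,_) (sym P-𝟎)

  α-F : G 𝟎 ≡ 𝟎 → ∀ x → α (F x) ≡ FK (α x)
  α-F G-𝟎 x = cong (F x ,_) (sym G-𝟎)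

  α-P : H 𝟎 ≡ 𝟎 → ∀ x → α (P x) ≡ PK (α x)
  α-P H-𝟎 x = cong (P x ,_) (sym H-𝟎)

lemma5p4 : {a : Level} {A : Set a} (L : TenseDLI+ A) → TenseDLI+.G L (TenseDLI+.𝟎 L) ≡ TenseDLI+.𝟎 L → TenseDLI+.H L (TenseDLI+.𝟎 L) ≡ TenseDLI+.𝟎 L → KConstruction.IsIsoOntoC L
lemma5p4 L G-𝟎 H-𝟎 =
  α-InC , α-injective , α-surjective , α-∧ , α-∨ , α-⇒ , refl , refl ,
  α-G , α-H , α-F G-𝟎 , α-P H-𝟎
  where open α-Properties L
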